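{- For every positive integer $d$, $$\det V(2,d)=d^{d(d+1)/2}\prod_{h=1}^{d}h!.$$
   Context: $V(2,d)$ is the $(d+1)\times(d+1)$ matrix $[(\alpha^i)^{\alpha^j}]_{i,j}$ where $\alpha^1,\dots,\alpha^{d+1}$ enumerate $B(2,d)=\{(\alpha_1,\alpha_2)\in\mathbb{N}^2:\alpha_1+\alpha_2=d\}$ ($\mathbb{N}=\{0,1,2,\dots\}$), and $\alpha^{\beta}=\alpha_1^{\beta_1}\alpha_2^{\beta_2}$ with $0^0=1$ (the determinant does not depend on the enumeration). -}

module Defs where

open import Data.Nat as ℕ using (ℕ; zero; suc; _∸_)
open import Data.Fin using (Fin; zero; suc; toℕ; punchIn)
open import Data.Integer as ℤ using (ℤ; +_)

sumFin : ∀ n → (Fin n → ℤ) → ℤ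
sumFin zero f = + 0
sumFin (suc n) f = f zero ℤ.+ sumFin n (λ i → f (suc i))

minor : ∀ {n} → (Fin (suc n) → Fin (suc n) → ℤ) → Fin (suc n) → Fin n → Fin n → ℤ
minor M j r c = M (suc r) (punchIn j c)

det : ∀ n → (Fin n → Fin n → ℤ) → ℤ
det zero M = + 1
det (suc n) M =
  sumFin (suc n) (λ j → ((ℤ.- + 1) ℤ.^ toℕ j) ℤ.* (M zero j ℤ.* det n (minor M j)))

-- V(2,d) with the enumeration α^i = (i, d - i), i = 0..d;
-- entry (i,j) is (α^i)^(α^j) = i^j * (d-i)^(d-j), with 0^0 = 1 (as ℕ._^_ does).
V2 : (d : ℕ) → Fin (suc d) → Fin (suc d) → ℤ
V2 d i j = + ((toℕ i ℕ.^ toℕ j) ℕ.* ((d ∸ toℕ i) ℕ.^ (d ∸ toℕ j)))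

prodFact : ℕ → ℕ
prodFact zero = 1
prodFact (suc d) = (suc d) ℕ.! ℕ.* prodFact d

{-# OPTIONS --safe #-}
module Submission where

-- With α^i = (i, d − i), V(2,d) is the homogeneous Vandermonde matrix [a_r^c b_r^(d−c)] for
-- a_r = r, b_r = d − r. Replacing every column c ≥ 1 by b₀·(column c) − a₀·(column c−1)
-- multiplies the determinant by b₀^d, leaves b₀^d as the only nonzero entry of row 0, and turns
-- row r into (a_r b₀ − a₀ b_r) times a row of the homogeneous Vandermonde matrix of size d.
-- Cancelling b₀^d ≠ 0 and recursing gives det = ∏_{r<s} (a_s b_r − a_r b_s); here each factor
-- is s(d − r) − r(d − s) = d(s − r), and the product is d^(d(d+1)/2) ∏_{h≤d} h!.

module IntegerDeterminant where

  open import Data.Bool.Base using (true; false; if_then_else_; T)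
  open import Data.Unit.Base using (tt)
  open import Data.Empty using (⊥-elim)
  open import Data.Fin.Base using (Fin; zero; suc; toℕ; punchIn; punchOut; inject₁; fromℕ; fromℕ<; pred)
  open import Data.Fin.Properties
    using (suc-injective; toℕ-injective; _≟_; toℕ-inject₁; toℕ-fromℕ; toℕ-fromℕ<; toℕ<n; punchIn-punchOut; punchInᵢ≢i; punchIn-injective)
  open import Data.Integer.Base as ℤ using (ℤ; +_; 0ℤ; 1ℤ; _+_; _*_; -_; _-_; _^_)
  import Data.Integer.Properties as ℤ
  open import Data.Integer.Tactic.RingSolver using (solve-∀)
  open import Data.Nat.Base as ℕ using (ℕ; zero; suc; _∸_; _<_; _≤_; s≤s; z≤n; _!)
  open import Data.Nat.DivMod using (_/_; +-distrib-/-∣ˡ; m*n/n≡m)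
  open import Data.Nat.Divisibility using (divides)
  import Data.Nat.Properties as ℕ
  import Data.Nat.Tactic.RingSolver as ℕ
  open import Data.Product.Base using (_×_; _,_)
  open import Data.Sum.Base using (_⊎_; inj₁; inj₂)
  open import Function.Base using (_∘_)
  open import Relation.Nullary.Decidable using (does; yes; no)
  open import Relation.Binary.PropositionalEquality
  open ≡-Reasoning

  open import Algebra.Properties.Semiring.Sum ℤ.+-*-semiring
    using (sum; sum-cong-≗; ∑-distrib-+; *-distribˡ-sum; sum-replicate-zero)
  open import Algebra.Properties.Monoid.Sum ℤ.*-1-monoid
    using () renaming (sum to product; sum-cong-≗ to product-cong; sum-init-last to product-init-last)
  open import Defs

  Matrix : ℕ → Set
  Matrix n = Fin n → Fin n → ℤ

  sign : ℕ → ℤ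
  sign k = (- 1ℤ) ^ k

  sumFin≡sum : ∀ n (f : Fin n → ℤ) → sumFin n f ≡ sum f
  sumFin≡sum zero    f = refl
  sumFin≡sum (suc n) f = cong (λ s → f zero + s) (sumFin≡sum n (λ k → f (suc k)))

  sum-zero : ∀ n {f : Fin n → ℤ} → (∀ i → f i ≡ 0ℤ) → sum f ≡ 0ℤ
  sum-zero n f≗0 = trans (sum-cong-≗ f≗0) (sum-replicate-zero n)

  laplaceTerm : ∀ {n} → Matrix (suc n) → Fin (suc n) → ℤ
  laplaceTerm {n} M j = sign (toℕ j) * (M zero j * det n (minor M j))

  det-laplace : ∀ n (M : Matrix (suc n)) → det (suc n) M ≡ sum (laplaceTerm M)
  det-laplace n M = sumFin≡sum (suc n) (laplaceTerm M)

  det-cong : ∀ n {M N : Matrix n} → (∀ r c → M r c ≡ N r c) → det n M ≡ det n N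
  det-cong zero    M≗N = refl
  det-cong (suc n) {M} {N} M≗N = begin
    det (suc n) M          ≡⟨ det-laplace n M ⟩
    sum (laplaceTerm M)    ≡⟨ sum-cong-≗ (λ j → cong₂ (λ u v → sign (toℕ j) * (u * v))
                                (M≗N zero j) (det-cong n (λ r c → M≗N (suc r) (punchIn j c)))) ⟩
    sum (laplaceTerm N)    ≡⟨ det-laplace n N ⟨
    det (suc n) N          ∎

  data Adjacent : ∀ {n} → Fin n → Fin n → Set where
    here  : ∀ {n} → Adjacent {suc (suc n)} zero (suc zero)
    there : ∀ {n} {i j : Fin n} → Adjacent i j → Adjacent (suc i) (suc j)

  Adjacent-inject₁-suc : ∀ {n} (i : Fin n) → Adjacent (inject₁ i) (suc i)
  Adjacent-inject₁-suc zero    = here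
  Adjacent-inject₁-suc (suc i) = there (Adjacent-inject₁-suc i)

  Adjacent⇒toℕ-suc : ∀ {n} {i j : Fin n} → Adjacent i j → toℕ j ≡ suc (toℕ i)
  Adjacent⇒toℕ-suc here      = refl
  Adjacent⇒toℕ-suc (there a) = cong suc (Adjacent⇒toℕ-suc a)

  Adjacent⇒≢ : ∀ {n} {i j : Fin n} → Adjacent i j → i ≢ j
  Adjacent⇒≢ here      ()
  Adjacent⇒≢ (there a) refl = Adjacent⇒≢ a refl

  Adjacent-punchOut : ∀ {n} {i j k : Fin (suc n)} → Adjacent i j →
                      (k≢i : k ≢ i) (k≢j : k ≢ j) → Adjacent (punchOut k≢i) (punchOut k≢j)
  Adjacent-punchOut {k = zero}  here      k≢i k≢j = ⊥-elim (k≢i refl)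
  Adjacent-punchOut {k = zero}  (there a) k≢i k≢j = a
  Adjacent-punchOut {k = suc zero} here k≢i k≢j = ⊥-elim (k≢j refl)
  Adjacent-punchOut {suc (suc n)} {k = suc (suc k)} here k≢i k≢j = here
  Adjacent-punchOut {suc n} {k = suc k} (there a) k≢i k≢j =
    there (Adjacent-punchOut a (k≢i ∘ cong suc) (k≢j ∘ cong suc))

  punchIn-Adjacent : ∀ {n} {i j : Fin (suc n)} → Adjacent i j → ∀ c →
                     punchIn i c ≡ punchIn j c ⊎ (punchIn i c ≡ j × punchIn j c ≡ i)
  punchIn-Adjacent here      zero    = inj₂ (refl , refl)
  punchIn-Adjacent here      (suc c) = inj₁ refl
  punchIn-Adjacent (there a) zero    = inj₁ refl
  punchIn-Adjacent (there a) (suc c) with punchIn-Adjacent a c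
  ... | inj₁ eq          = inj₁ (cong suc eq)
  ... | inj₂ (eqᵢ , eqⱼ) = inj₂ (cong suc eqᵢ , cong suc eqⱼ)

  sum-cancelling-adjacent : ∀ {n} (f : Fin n → ℤ) {i j : Fin n} → Adjacent i j →
                            (∀ k → k ≢ i → k ≢ j → f k ≡ 0ℤ) → f i + f j ≡ 0ℤ → sum f ≡ 0ℤ
  sum-cancelling-adjacent {suc (suc n)} f here f≗0 fᵢ+fⱼ≡0 = begin
    f zero + (f (suc zero) + rest)  ≡⟨ ℤ.+-assoc (f zero) (f (suc zero)) rest ⟨
    (f zero + f (suc zero)) + rest  ≡⟨ cong₂ _+_ fᵢ+fⱼ≡0 (sum-zero n (λ k → f≗0 (suc (suc k)) (λ ()) (λ ()))) ⟩
    0ℤ                              ∎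
    where rest = sum (λ k → f (suc (suc k)))
  sum-cancelling-adjacent {suc n} f (there a) f≗0 fᵢ+fⱼ≡0 =
    cong₂ _+_ (f≗0 zero (λ ()) (λ ()))
      (sum-cancelling-adjacent (λ k → f (suc k)) a
        (λ k k≢i k≢j → f≗0 (suc k) (k≢i ∘ suc-injective) (k≢j ∘ suc-injective)) fᵢ+fⱼ≡0)

  minor-adjacent : ∀ {n} (M : Matrix (suc n)) {i j : Fin (suc n)} → Adjacent i j →
                   (∀ r → M r i ≡ M r j) → ∀ r c → minor M i r c ≡ minor M j r c
  minor-adjacent M a Mᵢ≡Mⱼ r c with punchIn-Adjacent a c
  ... | inj₁ eq          = cong (M (suc r)) eq
  ... | inj₂ (eqᵢ , eqⱼ) = trans (cong (M (suc r)) eqᵢ) (trans (sym (Mᵢ≡Mⱼ (suc r))) (cong (M (suc r)) (sym eqⱼ)))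

  det-equal-adjacent-columns : ∀ n (M : Matrix n) {i j : Fin n} → Adjacent i j →
                               (∀ r → M r i ≡ M r j) → det n M ≡ 0ℤ
  det-equal-adjacent-columns (suc n) M {i} {j} a Mᵢ≡Mⱼ =
    trans (det-laplace n M) (sum-cancelling-adjacent (laplaceTerm M) a otherTerm pairTerms)
    where
    otherTerm : ∀ k → k ≢ i → k ≢ j → laplaceTerm M k ≡ 0ℤ
    otherTerm k k≢i k≢j = begin
      sign (toℕ k) * (M zero k * det n (minor M k))  ≡⟨ cong (λ D → sign (toℕ k) * (M zero k * D)) minorVanishes ⟩
      sign (toℕ k) * (M zero k * 0ℤ)                 ≡⟨ cong (sign (toℕ k) *_) (ℤ.*-zeroʳ (M zero k)) ⟩
      sign (toℕ k) * 0ℤ                              ≡⟨ ℤ.*-zeroʳ (sign (toℕ k)) ⟩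
      0ℤ                                             ∎
      where
      minorVanishes : det n (minor M k) ≡ 0ℤ
      minorVanishes = det-equal-adjacent-columns n (minor M k) (Adjacent-punchOut a k≢i k≢j) λ r → begin
        M (suc r) (punchIn k (punchOut k≢i))  ≡⟨ cong (M (suc r)) (punchIn-punchOut k≢i) ⟩
        M (suc r) i                           ≡⟨ Mᵢ≡Mⱼ (suc r) ⟩
        M (suc r) j                           ≡⟨ cong (M (suc r)) (punchIn-punchOut k≢j) ⟨
        M (suc r) (punchIn k (punchOut k≢j))  ∎
    pairTerms : laplaceTerm M i + laplaceTerm M j ≡ 0ℤ
    pairTerms = begin
      s * (m * D) + sign (toℕ j) * (M zero j * det n (minor M j))
        ≡⟨ cong₂ (λ e u → s * (m * D) + sign e * (u * det n (minor M j))) (Adjacent⇒toℕ-suc a) (sym (Mᵢ≡Mⱼ zero)) ⟩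
      s * (m * D) + (- 1ℤ * s) * (m * det n (minor M j))
        ≡⟨ cong (λ D′ → s * (m * D) + (- 1ℤ * s) * (m * D′)) (det-cong n (minor-adjacent M a Mᵢ≡Mⱼ)) ⟨
      s * (m * D) + (- 1ℤ * s) * (m * D)
        ≡⟨ cancel s m D ⟩
      0ℤ ∎
      where
      s = sign (toℕ i)
      m = M zero i
      D = det n (minor M i)
      cancel : ∀ s m D → s * (m * D) + (- 1ℤ * s) * (m * D) ≡ 0ℤ
      cancel = solve-∀

  AgreeOff : ∀ {n} → Fin n → Matrix n → Matrix n → Set
  AgreeOff c P M = ∀ r j → j ≢ c → P r j ≡ M r j

  minor-AgreeOff-at : ∀ {n} {P M : Matrix (suc n)} c → AgreeOff c P M → ∀ r j → minor P c r j ≡ minor M c r j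
  minor-AgreeOff-at c P≗M r j = P≗M (suc r) (punchIn c j) (punchInᵢ≢i c j)

  minor-AgreeOff : ∀ {n} {P M : Matrix (suc n)} {c k} (k≢c : k ≢ c) → AgreeOff c P M →
                   AgreeOff (punchOut k≢c) (minor P k) (minor M k)
  minor-AgreeOff {k = k} k≢c P≗M r j j≢c′ = P≗M (suc r) (punchIn k j) λ eq →
    j≢c′ (punchIn-injective k j (punchOut k≢c) (trans eq (sym (punchIn-punchOut k≢c))))

  det-linear-column : ∀ n (P M N : Matrix n) (c : Fin n) (x y : ℤ) → AgreeOff c P M → AgreeOff c P N →
                      (∀ r → P r c ≡ x * M r c + y * N r c) → det n P ≡ x * det n M + y * det n N
  det-linear-column (suc n) P M N c x y P≗M P≗N Pc = begin
    det (suc n) P                                          ≡⟨ det-laplace n P ⟩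
    sum (laplaceTerm P)                                    ≡⟨ sum-cong-≗ term ⟩
    sum (λ k → x * laplaceTerm M k + y * laplaceTerm N k)  ≡⟨ ∑-distrib-+ (λ k → x * laplaceTerm M k) (λ k → y * laplaceTerm N k) ⟩
    sum (λ k → x * laplaceTerm M k) + sum (λ k → y * laplaceTerm N k)
      ≡⟨ cong₂ _+_ (*-distribˡ-sum x (laplaceTerm M)) (*-distribˡ-sum y (laplaceTerm N)) ⟨
    x * sum (laplaceTerm M) + y * sum (laplaceTerm N)      ≡⟨ cong₂ (λ u v → x * u + y * v) (det-laplace n M) (det-laplace n N) ⟨
    x * det (suc n) M + y * det (suc n) N                  ∎
    where
    linearEntry : ∀ s x y a b D → s * ((x * a + y * b) * D) ≡ x * (s * (a * D)) + y * (s * (b * D))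
    linearEntry = solve-∀
    linearMinor : ∀ s x y a D E → s * (a * (x * D + y * E)) ≡ x * (s * (a * D)) + y * (s * (a * E))
    linearMinor = solve-∀
    term : ∀ k → laplaceTerm P k ≡ x * laplaceTerm M k + y * laplaceTerm N k
    term k with k ≟ c
    ... | yes refl = begin
      sign (toℕ k) * (P zero k * det n (minor P k))
        ≡⟨ cong₂ (λ u D → sign (toℕ k) * (u * D)) (Pc zero) (det-cong n (minor-AgreeOff-at k P≗M)) ⟩
      sign (toℕ k) * ((x * M zero k + y * N zero k) * det n (minor M k))
        ≡⟨ linearEntry (sign (toℕ k)) x y (M zero k) (N zero k) (det n (minor M k)) ⟩
      x * laplaceTerm M k + y * (sign (toℕ k) * (N zero k * det n (minor M k)))
        ≡⟨ cong (λ D → x * laplaceTerm M k + y * (sign (toℕ k) * (N zero k * D))) (det-cong n minorM≗N) ⟩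
      x * laplaceTerm M k + y * laplaceTerm N k ∎
      where
      minorM≗N : ∀ r j → minor M k r j ≡ minor N k r j
      minorM≗N r j = trans (sym (minor-AgreeOff-at k P≗M r j)) (minor-AgreeOff-at k P≗N r j)
    ... | no k≢c = begin
      sign (toℕ k) * (P zero k * det n (minor P k))
        ≡⟨ cong (λ D → sign (toℕ k) * (P zero k * D)) minorLinear ⟩
      sign (toℕ k) * (P zero k * (x * det n (minor M k) + y * det n (minor N k)))
        ≡⟨ linearMinor (sign (toℕ k)) x y (P zero k) (det n (minor M k)) (det n (minor N k)) ⟩
      x * (sign (toℕ k) * (P zero k * det n (minor M k))) + y * (sign (toℕ k) * (P zero k * det n (minor N k)))
        ≡⟨ cong₂ (λ u v → x * (sign (toℕ k) * (u * det n (minor M k))) + y * (sign (toℕ k) * (v * det n (minor N k))))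
             (P≗M zero k k≢c) (P≗N zero k k≢c) ⟩
      x * laplaceTerm M k + y * laplaceTerm N k ∎
      where
      minorLinear : det n (minor P k) ≡ x * det n (minor M k) + y * det n (minor N k)
      minorLinear = det-linear-column n (minor P k) (minor M k) (minor N k) (punchOut k≢c) x y
        (minor-AgreeOff k≢c P≗M) (minor-AgreeOff k≢c P≗N)
        (λ r → subst (λ j → P (suc r) j ≡ x * M (suc r) j + y * N (suc r) j) (sym (punchIn-punchOut k≢c)) (Pc (suc r)))

  det-add-adjacent-column : ∀ n (P Q : Matrix n) {i j : Fin n} (x y : ℤ) → Adjacent i j →
                            AgreeOff j P Q → (∀ r → P r j ≡ x * Q r j + y * Q r i) →
                            det n P ≡ x * det n Q
  det-add-adjacent-column n P Q {i} {j} x y a P≗Q Pⱼ = begin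
    det n P                   ≡⟨ det-linear-column n P Q N j x y P≗Q P≗N Pⱼ′ ⟩
    x * det n Q + y * det n N ≡⟨ cong (λ D → x * det n Q + y * D) (det-equal-adjacent-columns n N a Nᵢ≡Nⱼ) ⟩
    x * det n Q + y * 0ℤ      ≡⟨ cong (λ v → x * det n Q + v) (ℤ.*-zeroʳ y) ⟩
    x * det n Q + 0ℤ          ≡⟨ ℤ.+-identityʳ (x * det n Q) ⟩
    x * det n Q               ∎
    where
    N : Matrix n
    N r k = if does (k ≟ j) then Q r i else Q r k
    P≗N : AgreeOff j P N
    P≗N r k k≢j with k ≟ j
    ... | yes k≡j = ⊥-elim (k≢j k≡j)
    ... | no _    = P≗Q r k k≢j
    Pⱼ′ : ∀ r → P r j ≡ x * Q r j + y * N r j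
    Pⱼ′ r with j ≟ j
    ... | yes _   = Pⱼ r
    ... | no j≢j  = ⊥-elim (j≢j refl)
    Nᵢ≡Nⱼ : ∀ r → N r i ≡ N r j
    Nᵢ≡Nⱼ r with i ≟ j | j ≟ j
    ... | yes i≡j | _      = ⊥-elim (Adjacent⇒≢ a i≡j)
    ... | no _    | yes _  = refl
    ... | no _    | no j≢j = ⊥-elim (j≢j refl)

  -- Only the columns after position k are changed, so shear x y n M = M for a matrix of size
  -- n + 1, and lowering k one step at a time reaches the full column operation shear x y 0 M.
  shear : ∀ {n} → ℤ → ℤ → ℕ → Matrix n → Matrix n
  shear x y k M r c = if k ℕ.<ᵇ toℕ c then x * M r c + y * M r (pred c) else M r c

  shear-≤ : ∀ {n} x y k (M : Matrix n) r c → toℕ c ≤ k → shear x y k M r c ≡ M r c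
  shear-≤ x y k M r c c≤k with k ℕ.<ᵇ toℕ c in k<ᵇc
  ... | true  = ⊥-elim (ℕ.<⇒≱ (ℕ.<ᵇ⇒< k (toℕ c) (subst T (sym k<ᵇc) tt)) c≤k)
  ... | false = refl

  shear-> : ∀ {n} x y k (M : Matrix n) r c → k < toℕ c → shear x y k M r c ≡ x * M r c + y * M r (pred c)
  shear-> x y k M r c k<c with k ℕ.<ᵇ toℕ c in k<ᵇc
  ... | true  = refl
  ... | false = ⊥-elim (subst T k<ᵇc (ℕ.<⇒<ᵇ k<c))

  det-shear-step : ∀ n x y (M : Matrix (suc n)) k (e : Fin n) → toℕ e ≡ k →
                   det (suc n) (shear x y k M) ≡ x * det (suc n) (shear x y (suc k) M)
  det-shear-step n x y M .(toℕ e) e refl =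
    det-add-adjacent-column (suc n) (shear x y k M) (shear x y (suc k) M) x y
      (Adjacent-inject₁-suc e) offColumn column
    where
    k = toℕ e
    offColumn : AgreeOff (suc e) (shear x y k M) (shear x y (suc k) M)
    offColumn r c c≢e₁ with toℕ c ℕ.≤? k | suc k ℕ.<? toℕ c
    ... | yes c≤k | _        = trans (shear-≤ x y k M r c c≤k) (sym (shear-≤ x y (suc k) M r c (ℕ.m≤n⇒m≤1+n c≤k)))
    ... | no _    | yes k₁<c = trans (shear-> x y k M r c (ℕ.<-trans (ℕ.n<1+n k) k₁<c)) (sym (shear-> x y (suc k) M r c k₁<c))
    ... | no c≰k  | no k₁≮c  = ⊥-elim (c≢e₁ (toℕ-injective (ℕ.≤-antisym (ℕ.≮⇒≥ k₁≮c) (ℕ.≰⇒> c≰k))))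
    column : ∀ r → shear x y k M r (suc e) ≡ x * shear x y (suc k) M r (suc e) + y * shear x y (suc k) M r (inject₁ e)
    column r = begin
      shear x y k M r (suc e)                ≡⟨ shear-> x y k M r (suc e) (ℕ.n<1+n k) ⟩
      x * M r (suc e) + y * M r (inject₁ e)  ≡⟨ cong₂ (λ u v → x * u + y * v)
                                                  (shear-≤ x y (suc k) M r (suc e) ℕ.≤-refl)
                                                  (shear-≤ x y (suc k) M r (inject₁ e) (ℕ.≤-trans (ℕ.≤-reflexive (toℕ-inject₁ e)) (ℕ.n≤1+n k))) ⟨
      x * shear x y (suc k) M r (suc e) + y * shear x y (suc k) M r (inject₁ e) ∎

  det-shear-from : ∀ n x y (M : Matrix (suc n)) j k → j ℕ.+ k ≡ n →
                   det (suc n) (shear x y k M) ≡ x ^ j * det (suc n) M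
  det-shear-from n x y M zero k refl = begin
    det (suc n) (shear x y n M)  ≡⟨ det-cong (suc n) (λ r c → shear-≤ x y n M r c (ℕ.≤-pred (toℕ<n c))) ⟩
    det (suc n) M                ≡⟨ ℤ.*-identityˡ (det (suc n) M) ⟨
    1ℤ * det (suc n) M           ∎
  det-shear-from n x y M (suc j) k j₁+k≡n = begin
    det (suc n) (shear x y k M)            ≡⟨ det-shear-step n x y M k (fromℕ< k<n) (toℕ-fromℕ< k<n) ⟩
    x * det (suc n) (shear x y (suc k) M)  ≡⟨ cong (x *_) (det-shear-from n x y M j (suc k) (trans (ℕ.+-suc j k) j₁+k≡n)) ⟩
    x * (x ^ j * det (suc n) M)            ≡⟨ ℤ.*-assoc x (x ^ j) (det (suc n) M) ⟨
    x ^ suc j * det (suc n) M              ∎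
    where
    k<n : k < n
    k<n = subst (k <_) j₁+k≡n (s≤s (ℕ.m≤n+m k j))

  det-shear : ∀ n x y (M : Matrix (suc n)) → det (suc n) (shear x y 0 M) ≡ x ^ n * det (suc n) M
  det-shear n x y M = det-shear-from n x y M n 0 (ℕ.+-identityʳ n)

  det-scale-rows : ∀ n (L : Fin n → ℤ) (M : Matrix n) → det n (λ r c → L r * M r c) ≡ product L * det n M
  det-scale-rows zero    L M = refl
  det-scale-rows (suc n) L M = begin
    det (suc n) (λ r c → L r * M r c)  ≡⟨ det-laplace n (λ r c → L r * M r c) ⟩
    sum (λ k → sign (toℕ k) * ((L zero * M zero k) * det n (λ r c → L (suc r) * minor M k r c)))
      ≡⟨ sum-cong-≗ (λ k → trans (cong (λ D → sign (toℕ k) * ((L zero * M zero k) * D)) (det-scale-rows n (λ r → L (suc r)) (minor M k)))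
                                 (regroup (sign (toℕ k)) (L zero) (product (λ r → L (suc r))) (M zero k) (det n (minor M k)))) ⟩
    sum (λ k → product L * laplaceTerm M k)  ≡⟨ *-distribˡ-sum (product L) (laplaceTerm M) ⟨
    product L * sum (laplaceTerm M)          ≡⟨ cong (product L *_) (det-laplace n M) ⟨
    product L * det (suc n) M                ∎
    where
    regroup : ∀ s l p m D → s * ((l * m) * (p * D)) ≡ (l * p) * (s * (m * D))
    regroup = solve-∀

  det-first-row-zero-tail : ∀ n (M : Matrix (suc n)) → (∀ c → M zero (suc c) ≡ 0ℤ) →
                            det (suc n) M ≡ M zero zero * det n (minor M zero)
  det-first-row-zero-tail n M row₀ = begin
    det (suc n) M                                           ≡⟨ det-laplace n M ⟩
    laplaceTerm M zero + sum (λ c → laplaceTerm M (suc c))  ≡⟨ cong₂ _+_ (ℤ.*-identityˡ pivotTerm) (sum-zero n tailVanishes) ⟩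
    pivotTerm + 0ℤ                                          ≡⟨ ℤ.+-identityʳ pivotTerm ⟩
    pivotTerm                                               ∎
    where
    pivotTerm = M zero zero * det n (minor M zero)
    tailVanishes : ∀ c → laplaceTerm M (suc c) ≡ 0ℤ
    tailVanishes c = begin
      sign (suc (toℕ c)) * (M zero (suc c) * det n (minor M (suc c)))
        ≡⟨ cong (λ u → sign (suc (toℕ c)) * (u * det n (minor M (suc c)))) (row₀ c) ⟩
      sign (suc (toℕ c)) * (0ℤ * det n (minor M (suc c)))
        ≡⟨ ℤ.*-zeroʳ (sign (suc (toℕ c))) ⟩
      0ℤ ∎

  homVandermonde : ∀ m → (Fin (suc m) → ℤ) → (Fin (suc m) → ℤ) → Matrix (suc m)
  homVandermonde m a b r c = a r ^ toℕ c * b r ^ (m ∸ toℕ c)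

  vandermondeProduct : ∀ m → (Fin (suc m) → ℤ) → (Fin (suc m) → ℤ) → ℤ
  vandermondeProduct zero    a b = 1ℤ
  vandermondeProduct (suc m) a b =
    product (λ r → a (suc r) * b zero - a zero * b (suc r)) * vandermondeProduct m (λ r → a (suc r)) (λ r → b (suc r))

  eliminate-monomial : ∀ m i (x y a₀ b₀ : ℤ) → i ≤ m →
    b₀ * (x ^ suc i * y ^ (m ∸ i)) + (- a₀) * (x ^ i * y ^ (suc m ∸ i)) ≡ (x * b₀ - a₀ * y) * (x ^ i * y ^ (m ∸ i))
  eliminate-monomial m i x y a₀ b₀ i≤m rewrite ℕ.+-∸-assoc 1 i≤m = factor x y a₀ b₀ (x ^ i) (y ^ (m ∸ i))
    where
    factor : ∀ x y a₀ b₀ X Y → b₀ * ((x * X) * Y) + (- a₀) * (X * (y * Y)) ≡ (x * b₀ - a₀ * y) * (X * Y)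
    factor = solve-∀

  shear-homVandermonde : ∀ m (a b : Fin (suc (suc m)) → ℤ) r (c : Fin (suc m)) →
    shear (b zero) (- a zero) 0 (homVandermonde (suc m) a b) r (suc c) ≡ (a r * b zero - a zero * b r) * (a r ^ toℕ c * b r ^ (m ∸ toℕ c))
  shear-homVandermonde m a b r c = begin
    shear (b zero) (- a zero) 0 (homVandermonde (suc m) a b) r (suc c)
      ≡⟨ shear-> (b zero) (- a zero) 0 (homVandermonde (suc m) a b) r (suc c) (s≤s z≤n) ⟩
    b zero * (a r ^ suc (toℕ c) * b r ^ (m ∸ toℕ c)) + (- a zero) * (a r ^ toℕ (inject₁ c) * b r ^ (suc m ∸ toℕ (inject₁ c)))
      ≡⟨ cong (λ i → b zero * (a r ^ suc (toℕ c) * b r ^ (m ∸ toℕ c)) + (- a zero) * (a r ^ i * b r ^ (suc m ∸ i))) (toℕ-inject₁ c) ⟩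
    b zero * (a r ^ suc (toℕ c) * b r ^ (m ∸ toℕ c)) + (- a zero) * (a r ^ toℕ c * b r ^ (suc m ∸ toℕ c))
      ≡⟨ eliminate-monomial m (toℕ c) (a r) (b r) (a zero) (b zero) (ℕ.≤-pred (toℕ<n c)) ⟩
    (a r * b zero - a zero * b r) * (a r ^ toℕ c * b r ^ (m ∸ toℕ c)) ∎

  -- b_0, …, b_(m−1) are the pivots that get cancelled; b_m may vanish (b_d = d − d in V(2,d)).
  det-homVandermonde : ∀ m (a b : Fin (suc m) → ℤ) → (∀ r → toℕ r < m → b r ≢ 0ℤ) →
                       det (suc m) (homVandermonde m a b) ≡ vandermondeProduct m a b
  det-homVandermonde zero    a b b≢0 = refl
  det-homVandermonde (suc m) a b b≢0 = ℤ.*-cancelˡ-≡ (b₀ ^ suc m) _ _ ⦃ ℤ.≢-nonZero b₀^m₁≢0 ⦄ (begin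
    b₀ ^ suc m * det (suc (suc m)) V              ≡⟨ det-shear (suc m) b₀ (- a₀) V ⟨
    det (suc (suc m)) W                           ≡⟨ det-first-row-zero-tail (suc m) W row₀ ⟩
    W zero zero * det (suc m) (minor W zero)      ≡⟨ cong₂ _*_ (ℤ.*-identityˡ (b₀ ^ suc m)) minor-W ⟩
    b₀ ^ suc m * vandermondeProduct (suc m) a b   ∎)
    where
    a₀ = a zero
    b₀ = b zero
    V = homVandermonde (suc m) a b
    W = shear b₀ (- a₀) 0 V
    L : Fin (suc m) → ℤ
    L r = a (suc r) * b₀ - a₀ * b (suc r)
    V′ = homVandermonde m (λ r → a (suc r)) (λ r → b (suc r))
    b₀^m₁≢0 : b₀ ^ suc m ≢ 0ℤ
    b₀^m₁≢0 = b₀≢0 ∘ ℤ.i^n≡0⇒i≡0 b₀ (suc m)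
      where b₀≢0 = b≢0 zero (s≤s z≤n)
    row₀ : ∀ c → W zero (suc c) ≡ 0ℤ
    row₀ c = begin
      W zero (suc c)                           ≡⟨ shear-homVandermonde m a b zero c ⟩
      (a₀ * b₀ - a₀ * b₀) * X                  ≡⟨ cong (_* X) (ℤ.+-inverseʳ (a₀ * b₀)) ⟩
      0ℤ * X                                   ≡⟨ ℤ.*-zeroˡ X ⟩
      0ℤ                                       ∎
      where X = a₀ ^ toℕ c * b₀ ^ (m ∸ toℕ c)
    minor-W : det (suc m) (minor W zero) ≡ vandermondeProduct (suc m) a b
    minor-W = begin
      det (suc m) (minor W zero)
        ≡⟨ det-cong (suc m) (λ r c → shear-homVandermonde m a b (suc r) c) ⟩
      det (suc m) (λ r c → L r * V′ r c)
        ≡⟨ det-scale-rows (suc m) L V′ ⟩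
      product L * det (suc m) V′
        ≡⟨ cong (product L *_)
             (det-homVandermonde m (λ r → a (suc r)) (λ r → b (suc r)) (λ r r<m → b≢0 (suc r) (s≤s r<m))) ⟩
      vandermondeProduct (suc m) a b ∎

  triangular : ℕ → ℕ
  triangular m = m ℕ.* suc m / 2

  triangular-suc : ∀ m → triangular (suc m) ≡ suc m ℕ.+ triangular m
  triangular-suc m = begin
    suc m ℕ.* suc (suc m) / 2            ≡⟨ cong (_/ 2) (expand m) ⟩
    (suc m ℕ.* 2 ℕ.+ m ℕ.* suc m) / 2    ≡⟨ +-distrib-/-∣ˡ (m ℕ.* suc m) (divides (suc m) refl) ⟩
    suc m ℕ.* 2 / 2 ℕ.+ m ℕ.* suc m / 2  ≡⟨ cong (ℕ._+ m ℕ.* suc m / 2) (m*n/n≡m (suc m) 2) ⟩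
    suc m ℕ.+ m ℕ.* suc m / 2            ∎
    where
    expand : ∀ m → suc m ℕ.* suc (suc m) ≡ suc m ℕ.* 2 ℕ.+ m ℕ.* suc m
    expand = ℕ.solve-∀

  powerProdFact-suc : ∀ d m → d ℕ.^ triangular (suc m) ℕ.* prodFact (suc m) ≡
                      (d ℕ.^ suc m ℕ.* suc m !) ℕ.* (d ℕ.^ triangular m ℕ.* prodFact m)
  powerProdFact-suc d m = begin
    d ℕ.^ triangular (suc m) ℕ.* prodFact (suc m)
      ≡⟨ cong (λ e → d ℕ.^ e ℕ.* prodFact (suc m)) (triangular-suc m) ⟩
    d ℕ.^ (suc m ℕ.+ triangular m) ℕ.* prodFact (suc m)
      ≡⟨ cong (ℕ._* prodFact (suc m)) (ℕ.^-distribˡ-+-* d (suc m) (triangular m)) ⟩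
    (d ℕ.^ suc m ℕ.* d ℕ.^ triangular m) ℕ.* (suc m ! ℕ.* prodFact m)
      ≡⟨ interchange (d ℕ.^ suc m) (d ℕ.^ triangular m) (suc m !) (prodFact m) ⟩
    (d ℕ.^ suc m ℕ.* suc m !) ℕ.* (d ℕ.^ triangular m ℕ.* prodFact m) ∎
    where
    interchange : ∀ p q r s → (p ℕ.* q) ℕ.* (r ℕ.* s) ≡ (p ℕ.* r) ℕ.* (q ℕ.* s)
    interchange = ℕ.solve-∀

  product-multiples : ∀ d n → product (λ (r : Fin n) → + (d ℕ.* suc (toℕ r))) ≡ + (d ℕ.^ n ℕ.* n !)
  product-multiples d zero    = refl
  product-multiples d (suc n) = begin
    product f                                       ≡⟨ product-init-last f ⟩
    product (λ r → f (inject₁ r)) * f (fromℕ n)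
      ≡⟨ cong₂ _*_ (product-cong {n} (λ r → cong (λ t → + (d ℕ.* suc t)) (toℕ-inject₁ r)))
                   (cong (λ t → + (d ℕ.* suc t)) (toℕ-fromℕ n)) ⟩
    product (λ (r : Fin n) → + (d ℕ.* suc (toℕ r))) * + (d ℕ.* suc n)
      ≡⟨ cong (_* + (d ℕ.* suc n)) (product-multiples d n) ⟩
    + (d ℕ.^ n ℕ.* n !) * + (d ℕ.* suc n)            ≡⟨ ℤ.pos-* (d ℕ.^ n ℕ.* n !) (d ℕ.* suc n) ⟨
    + (d ℕ.^ n ℕ.* n ! ℕ.* (d ℕ.* suc n))            ≡⟨ cong +_ (regroup d n (d ℕ.^ n) (n !)) ⟩
    + (d ℕ.^ suc n ℕ.* suc n !)                      ∎
    where
    f : Fin (suc n) → ℤ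
    f r = + (d ℕ.* suc (toℕ r))
    regroup : ∀ d n p q → p ℕ.* q ℕ.* (d ℕ.* suc n) ≡ (d ℕ.* p) ℕ.* (suc n ℕ.* q)
    regroup = ℕ.solve-∀

  vandermondeProduct-arithmetic : ∀ d m (a b : Fin (suc m) → ℤ) →
    (∀ r → a r ≡ a zero + + toℕ r) → (∀ r → b r ≡ + d - a r) →
    vandermondeProduct m a b ≡ + (d ℕ.^ triangular m ℕ.* prodFact m)
  vandermondeProduct-arithmetic d zero    a b a≡a₀+r b≡d-a = refl
  vandermondeProduct-arithmetic d (suc m) a b a≡a₀+r b≡d-a = begin
    product L * vandermondeProduct m (λ r → a (suc r)) (λ r → b (suc r))
      ≡⟨ cong₂ _*_ (trans (product-cong {suc m} L≡multiple) (product-multiples d (suc m)))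
                   (vandermondeProduct-arithmetic d m (λ r → a (suc r)) (λ r → b (suc r)) a∘suc-arithmetic (λ r → b≡d-a (suc r))) ⟩
    + (d ℕ.^ suc m ℕ.* suc m !) * + (d ℕ.^ triangular m ℕ.* prodFact m)
      ≡⟨ ℤ.pos-* (d ℕ.^ suc m ℕ.* suc m !) (d ℕ.^ triangular m ℕ.* prodFact m) ⟨
    + ((d ℕ.^ suc m ℕ.* suc m !) ℕ.* (d ℕ.^ triangular m ℕ.* prodFact m))
      ≡⟨ cong +_ (powerProdFact-suc d m) ⟨
    + (d ℕ.^ triangular (suc m) ℕ.* prodFact (suc m)) ∎
    where
    a₀ = a zero
    L : Fin (suc m) → ℤ
    L r = a (suc r) * b zero - a₀ * b (suc r)
    cross : ∀ a₀ s D → (a₀ + s) * (D - a₀) - a₀ * (D - (a₀ + s)) ≡ D * s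
    cross = solve-∀
    L≡multiple : ∀ r → L r ≡ + (d ℕ.* suc (toℕ r))
    L≡multiple r = begin
      a (suc r) * b zero - a₀ * b (suc r)
        ≡⟨ cong₂ (λ u v → u * b zero - a₀ * v) (a≡a₀+r (suc r)) (b≡d-a (suc r)) ⟩
      (a₀ + + suc (toℕ r)) * b zero - a₀ * (+ d - a (suc r))
        ≡⟨ cong₂ (λ u v → (a₀ + + suc (toℕ r)) * u - a₀ * (+ d - v)) (b≡d-a zero) (a≡a₀+r (suc r)) ⟩
      (a₀ + + suc (toℕ r)) * (+ d - a₀) - a₀ * (+ d - (a₀ + + suc (toℕ r)))
        ≡⟨ cross a₀ (+ suc (toℕ r)) (+ d) ⟩
      + d * + suc (toℕ r)
        ≡⟨ ℤ.pos-* d (suc (toℕ r)) ⟨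
      + (d ℕ.* suc (toℕ r)) ∎
    reassoc : ∀ a₀ r → a₀ + (1ℤ + r) ≡ (a₀ + 1ℤ) + r
    reassoc = solve-∀
    a∘suc-arithmetic : ∀ r → a (suc r) ≡ a (suc zero) + + toℕ r
    a∘suc-arithmetic r = begin
      a (suc r)                 ≡⟨ a≡a₀+r (suc r) ⟩
      a₀ + + suc (toℕ r)        ≡⟨ cong (λ s → a₀ + s) (ℤ.pos-+ 1 (toℕ r)) ⟩
      a₀ + (1ℤ + + toℕ r)       ≡⟨ reassoc a₀ (+ toℕ r) ⟩
      (a₀ + 1ℤ) + + toℕ r       ≡⟨ cong (_+ + toℕ r) (a≡a₀+r (suc zero)) ⟨
      a (suc zero) + + toℕ r    ∎

  pos-^ : ∀ m n → + (m ℕ.^ n) ≡ (+ m) ^ n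
  pos-^ m zero    = refl
  pos-^ m (suc n) = trans (ℤ.pos-* m (m ℕ.^ n)) (cong (+ m *_) (pos-^ m n))

  V2≡homVandermonde : ∀ d r c → V2 d r c ≡ homVandermonde d (λ r → + toℕ r) (λ r → + (d ∸ toℕ r)) r c
  V2≡homVandermonde d r c = begin
    + (toℕ r ℕ.^ toℕ c ℕ.* (d ∸ toℕ r) ℕ.^ (d ∸ toℕ c))   ≡⟨ ℤ.pos-* (toℕ r ℕ.^ toℕ c) _ ⟩
    + (toℕ r ℕ.^ toℕ c) * + ((d ∸ toℕ r) ℕ.^ (d ∸ toℕ c)) ≡⟨ cong₂ _*_ (pos-^ (toℕ r) (toℕ c)) (pos-^ (d ∸ toℕ r) (d ∸ toℕ c)) ⟩
    (+ toℕ r) ^ toℕ c * (+ (d ∸ toℕ r)) ^ (d ∸ toℕ c)      ∎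

open import Defs
open import Data.Fin.Base using (Fin; toℕ)
open import Data.Fin.Properties using (toℕ<n)
open import Data.Integer.Base as ℤ using (ℤ; +_)
import Data.Integer.Properties as ℤ
open import Data.Nat.Base using (ℕ; suc; _∸_; _<_; _*_; _^_; _≤_)
open import Data.Nat.DivMod using (_/_)
import Data.Nat.Properties as ℕ
open import Function.Base using (_∘_)
open import Relation.Binary.PropositionalEquality
open ≡-Reasoning
open IntegerDeterminant

theorem6 : (d : ℕ) → 1 ≤ d →
    det (suc d) (V2 d) ≡ + ((d ^ ((d * suc d) / 2)) * prodFact d)
theorem6 d _ = begin
  det (suc d) (V2 d)                            ≡⟨ det-cong (suc d) (V2≡homVandermonde d) ⟩
  det (suc d) (homVandermonde d a b)            ≡⟨ det-homVandermonde d a b b≢0 ⟩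
  vandermondeProduct d a b                      ≡⟨ vandermondeProduct-arithmetic d d a b (λ r → refl) b≡d-a ⟩
  + (d ^ (d * suc d / 2) * prodFact d)          ∎
  where
  a b : Fin (suc d) → ℤ
  a r = + toℕ r
  b r = + (d ∸ toℕ r)
  b≡d-a : ∀ r → b r ≡ + d ℤ.- a r
  b≡d-a r = sym (trans (ℤ.m-n≡m⊖n d (toℕ r)) (ℤ.⊖-≥ (ℕ.≤-pred (toℕ<n r))))
  b≢0 : ∀ r → toℕ r < d → b r ≢ ℤ.0ℤ
  b≢0 r r<d = ℕ.m>n⇒m∸n≢0 r<d ∘ ℤ.+-injective
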